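{- For all integers $n,t\ge 1$, $\xi^\star_n(t)\le \mathrm{mad}^\star(t,\mathcal{O}^\star)$.
   Context: For $0\le k<n$, $\mathcal{A}\subseteq\binom{[n]}{k}$ and $\mathcal{B}\subseteq\binom{[n]}{k+1}$, let $\xi(\mathcal{A},\mathcal{B})$ be the number of pairs $(A,B)\in\mathcal{A}\times\mathcal{B}$ with $A\subseteq B$. $\xi^\star_n(t)$ is the maximum of $2\xi(\mathcal{A},\mathcal{B})/t$ over all $0\le k<n$ and all $\mathcal{A}\subseteq\binom{[n]}{k}$, $\mathcal{B}\subseteq\binom{[n]}{k+1}$ with $|\mathcal{A}|+|\mathcal{B}|=t$. A proper edge-colouring of a graph assigns colours to edges so that incident edges get distinct colours; a cycle is rainbow if its edges have pairwise distinct colours. $\mathrm{mad}^\star(t,\mathcal{O}^\star)$ is the largest average degree of a graph on $t$ vertices admitting a proper edge-colouring with no rainbow cycle. -}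

module Defs where

open import Data.Nat using (ℕ; suc; _+_; _≤_)
open import Data.Fin using (Fin) renaming (_<_ to _<ᶠ_)
open import Data.Fin.Subset using (Subset; ∣_∣; _⊆_)
open import Data.Fin.Subset.Properties using (_⊆?_)
open import Data.List using (List; []; _∷_; length; filter; map; zip; _++_; [_])
open import Data.Nat.ListAction using (sum)
open import Data.List.Relation.Unary.All using (All)
open import Data.List.Relation.Unary.Unique.Propositional using (Unique)
open import Data.List.Membership.Propositional using (_∈_)
open import Data.Product using (_×_; _,_; proj₁; proj₂)
open import Data.Sum using (_⊎_)
open import Relation.Nullary using (¬_)
open import Relation.Binary.PropositionalEquality using (_≡_; _≢_)

Family : (n k : ℕ) → List (Subset n) → Set
Family n k 𝒜 = Unique 𝒜 × All (λ A → ∣ A ∣ ≡ k) 𝒜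

ξ : ∀ {n} → List (Subset n) → List (Subset n) → ℕ
ξ 𝒜 ℬ = sum (map (λ A → length (filter (A ⊆?_) ℬ)) 𝒜)

record ColouredGraph (t : ℕ) : Set where
  field
    -- each edge {u,v} is stored once, as (u , v) with u < v
    edges   : List (Fin t × Fin t)
    ordered : All (λ e → proj₁ e <ᶠ proj₂ e) edges
    nodup   : Unique edges
    -- colour of the edge {u,v}; only its values on edges matter
    colour  : Fin t → Fin t → ℕ
    colour-sym : ∀ u v → colour u v ≡ colour v u

open ColouredGraph public

numEdges : ∀ {t} → ColouredGraph t → ℕ
numEdges G = length (edges G)

Adj : ∀ {t} → ColouredGraph t → Fin t → Fin t → Set
Adj G u v = (u , v) ∈ edges G ⊎ (v , u) ∈ edges G

Proper : ∀ {t} → ColouredGraph t → Set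
Proper G = ∀ u v w → Adj G u v → Adj G u w → v ≢ w → colour G u v ≢ colour G u w

cycleEdges : ∀ {t} → List (Fin t) → List (Fin t × Fin t)
cycleEdges []       = []
cycleEdges (v ∷ vs) = zip (v ∷ vs) (vs ++ [ v ])

IsCycle : ∀ {t} → ColouredGraph t → List (Fin t) → Set
IsCycle G vs = 3 ≤ length vs × Unique vs × All (λ e → Adj G (proj₁ e) (proj₂ e)) (cycleEdges vs)

Rainbow : ∀ {t} → ColouredGraph t → List (Fin t) → Set
Rainbow G vs = Unique (map (λ e → colour G (proj₁ e) (proj₂ e)) (cycleEdges vs))

NoRainbowCycle : ∀ {t} → ColouredGraph t → Set
NoRainbowCycle G = ∀ vs → IsCycle G vs → ¬ Rainbow G vs

-- Join each A ∈ 𝒜 to each B ∈ ℬ containing it and colour the edge by the unique element of B ∖ A,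
-- so that the labels of adjacent vertices differ in exactly the coordinate given by the colour.
-- The colouring is proper because from a given vertex two edges of the same colour lead to the
-- same set. On a cycle, the coordinate flipped by the first edge has to be flipped back by some
-- other edge, which then has the same colour; so no cycle is rainbow.
module Submission where

open import Defs
open import Data.Nat using (ℕ; suc; _+_; _≤_; _<_; s≤s)
open import Data.Fin.Subset using (Subset)
open import Data.List using (List; length)
open import Data.Product using (Σ; _×_)
open import Relation.Binary.PropositionalEquality using (_≡_)

open import Data.Bool using (true; false; not; if_then_else_; _xor_)
open import Data.Bool.Properties using (not-involutive; not-¬; xor-comm; xor-same)
open import Data.Fin using (Fin; toℕ; _↑ˡ_; _↑ʳ_; splitAt; join) renaming (zero to fzero; suc to fsuc; _<_ to _<ᶠ_)
open import Data.Fin.Properties using (toℕ-injective; toℕ-↑ˡ; toℕ-↑ʳ; ↑ˡ-injective; ↑ʳ-injective; splitAt-↑ˡ; splitAt-↑ʳ; join-splitAt; toℕ<n)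
open import Data.Fin.Subset using (∣_∣; _⊆_; inside; outside)
open import Data.Fin.Subset.Properties using (_⊆?_; drop-∷-⊆; p⊆q⇒∣p∣≤∣q∣)
open import Data.List using ([]; _∷_; filter; map; zip; _++_; [_]; lookup; allFin; cartesianProduct)
open import Data.List.Properties using (length-++; length-map; map-tabulate; tabulate-lookup; map-∘; map-cong; filter-++)
open import Data.List.Membership.Propositional.Properties using (∈-lookup)
open import Data.List.Relation.Unary.All using (All; []; _∷_)
import Data.List.Relation.Unary.All as All
import Data.List.Relation.Unary.All.Properties as All
open import Data.List.Relation.Unary.AllPairs using (_∷_)
open import Data.List.Relation.Unary.Unique.Propositional using (Unique)
import Data.List.Relation.Unary.Unique.Propositional.Properties as Unique
open import Data.Nat.ListAction using (sum)
open import Data.Nat.Properties using (1+n≢n; ≤-pred; ≤⇒≯; ≤-reflexive; ≤-trans; m≤m+n; suc-injective)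
open import Data.Product using (_,_; proj₁; proj₂; ∃-syntax)
import Data.Product as Product
open import Data.Sum using (inj₁; inj₂; [_,_]′)
open import Data.Vec using (here; _[_]%=_) renaming (_∷_ to _∷ᵛ_; [] to []ᵛ; lookup to lookupᵛ)
open import Data.Vec.Properties using (updateAt-updateAt; updateAt-id-local; lookup∘updateAt; lookup∘updateAt′)
open import Function using (_∘_)
open import Function.Definitions using (Injective)
open import Relation.Binary.PropositionalEquality using (_≢_; refl; sym; trans; cong; cong₂; module ≡-Reasoning)
open import Relation.Nullary using (does; contradiction)
open import Relation.Unary using (Decidable)

private
  variable
    A B : Set
    n : ℕ
    i j : Fin n
    p q r : Subset n

Flip : Fin n → Subset n → Subset n → Set
Flip i p q = q ≡ p [ i ]%= not

flip-sym : Flip i p q → Flip i q p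
flip-sym {i = i} {p = p} refl =
  sym (trans (updateAt-updateAt i p) (updateAt-id-local i p (not-involutive (lookupᵛ p i))))

flip-changes : Flip i p q → lookupᵛ p i ≢ lookupᵛ q i
flip-changes {i = i} {p = p} refl eq = not-¬ refl (trans eq (lookup∘updateAt i p))

flip-preserves : Flip i p q → j ≢ i → lookupᵛ p j ≡ lookupᵛ q j
flip-preserves {i = i} {p = p} {j = j} refl j≢i = sym (lookup∘updateAt′ j i j≢i p)

flip-unique : Flip i p q → Flip i p r → q ≡ r
flip-unique p→q p→r = trans p→q (sym p→r)

firstDiff : Subset n → Subset n → ℕ
firstDiff []ᵛ       []ᵛ       = 0
firstDiff (x ∷ᵛ p) (y ∷ᵛ q) = if x xor y then 0 else suc (firstDiff p q)

firstDiff-comm : (p q : Subset n) → firstDiff p q ≡ firstDiff q p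
firstDiff-comm []ᵛ       []ᵛ       = refl
firstDiff-comm (x ∷ᵛ p) (y ∷ᵛ q) rewrite xor-comm x y | firstDiff-comm p q = refl

firstDiff-flip : Flip i p q → firstDiff p q ≡ toℕ i
firstDiff-flip {i = fzero}  {p = outside ∷ᵛ p} refl = refl
firstDiff-flip {i = fzero}  {p = inside  ∷ᵛ p} refl = refl
firstDiff-flip {i = fsuc i} {p = x ∷ᵛ p}       refl rewrite xor-same x =
  cong suc (firstDiff-flip {i = i} {p = p} refl)

p⊆q∧∣q∣≤∣p∣⇒p≡q : p ⊆ q → ∣ q ∣ ≤ ∣ p ∣ → p ≡ q
p⊆q∧∣q∣≤∣p∣⇒p≡q {p = []ᵛ}          {q = []ᵛ}          _   _  = refl
p⊆q∧∣q∣≤∣p∣⇒p≡q {p = outside ∷ᵛ p} {q = outside ∷ᵛ q} p⊆q le =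
  cong (outside ∷ᵛ_) (p⊆q∧∣q∣≤∣p∣⇒p≡q (drop-∷-⊆ p⊆q) le)
p⊆q∧∣q∣≤∣p∣⇒p≡q {p = outside ∷ᵛ p} {q = inside  ∷ᵛ q} p⊆q le =
  contradiction le (≤⇒≯ (p⊆q⇒∣p∣≤∣q∣ (drop-∷-⊆ p⊆q)))
p⊆q∧∣q∣≤∣p∣⇒p≡q {p = inside  ∷ᵛ p} {q = outside ∷ᵛ q} p⊆q _  with p⊆q here
... | ()
p⊆q∧∣q∣≤∣p∣⇒p≡q {p = inside  ∷ᵛ p} {q = inside  ∷ᵛ q} p⊆q le =
  cong (inside ∷ᵛ_) (p⊆q∧∣q∣≤∣p∣⇒p≡q (drop-∷-⊆ p⊆q) (≤-pred le))

p⊆q∧∣q∣≡1+∣p∣⇒flip : p ⊆ q → ∣ q ∣ ≡ suc ∣ p ∣ → ∃[ i ] Flip i p q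
p⊆q∧∣q∣≡1+∣p∣⇒flip {p = outside ∷ᵛ p} {q = outside ∷ᵛ q} p⊆q eq =
  Product.map fsuc (cong (outside ∷ᵛ_)) (p⊆q∧∣q∣≡1+∣p∣⇒flip (drop-∷-⊆ p⊆q) eq)
p⊆q∧∣q∣≡1+∣p∣⇒flip {p = outside ∷ᵛ p} {q = inside  ∷ᵛ q} p⊆q eq =
  fzero , cong (inside ∷ᵛ_) (sym (p⊆q∧∣q∣≤∣p∣⇒p≡q (drop-∷-⊆ p⊆q) (≤-reflexive (suc-injective eq))))
p⊆q∧∣q∣≡1+∣p∣⇒flip {p = inside  ∷ᵛ p} {q = outside ∷ᵛ q} p⊆q _  with p⊆q here
... | ()
p⊆q∧∣q∣≡1+∣p∣⇒flip {p = inside  ∷ᵛ p} {q = inside  ∷ᵛ q} p⊆q eq =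
  Product.map fsuc (cong (inside ∷ᵛ_)) (p⊆q∧∣q∣≡1+∣p∣⇒flip (drop-∷-⊆ p⊆q) (suc-injective eq))

lookup-injective : {xs : List A} → Unique xs → Injective _≡_ _≡_ (lookup xs)
lookup-injective (_     ∷ _)     {fzero}  {fzero}  _  = refl
lookup-injective (x∉xs ∷ _)     {fzero}  {fsuc j} eq = contradiction eq (All.lookup x∉xs (∈-lookup j))
lookup-injective (x∉xs ∷ _)     {fsuc i} {fzero}  eq = contradiction (sym eq) (All.lookup x∉xs (∈-lookup i))
lookup-injective (_     ∷ uniq) {fsuc i} {fsuc j} eq = cong fsuc (lookup-injective uniq eq)

[,]′-injective : ∀ {C : Set} {f : A → C} {g : B → C} →
  Injective _≡_ _≡_ f → Injective _≡_ _≡_ g → (∀ x y → f x ≢ g y) → Injective _≡_ _≡_ [ f , g ]′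
[,]′-injective f-inj g-inj disjoint {inj₁ x} {inj₁ x′} eq = cong inj₁ (f-inj eq)
[,]′-injective f-inj g-inj disjoint {inj₁ x} {inj₂ y}  eq = contradiction eq (disjoint x y)
[,]′-injective f-inj g-inj disjoint {inj₂ y} {inj₁ x}  eq = contradiction (sym eq) (disjoint x y)
[,]′-injective f-inj g-inj disjoint {inj₂ y} {inj₂ y′} eq = cong inj₂ (g-inj eq)

splitAt-injective : ∀ m {n} → Injective _≡_ _≡_ (splitAt m {n})
splitAt-injective m {n} {i} {j} eq =
  trans (sym (join-splitAt m n i)) (trans (cong (join m n) eq) (join-splitAt m n j))

map-lookup-allFin : (xs : List A) → map (lookup xs) (allFin (length xs)) ≡ xs
map-lookup-allFin xs = trans (map-tabulate (λ i → i) (lookup xs)) (tabulate-lookup xs)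

length-filter-map : ∀ {P : B → Set} (P? : Decidable P) (f : A → B) xs →
  length (filter P? (map f xs)) ≡ length (filter (P? ∘ f) xs)
length-filter-map P? f []       = refl
length-filter-map P? f (x ∷ xs) with does (P? (f x))
... | true  = cong suc (length-filter-map P? f xs)
... | false = length-filter-map P? f xs

length-filter-cartesianProduct : ∀ {P : A × B → Set} (P? : Decidable P) xs ys →
  length (filter P? (cartesianProduct xs ys)) ≡ sum (map (λ x → length (filter (P? ∘ (x ,_)) ys)) xs)
length-filter-cartesianProduct P? []       ys = refl
length-filter-cartesianProduct P? (x ∷ xs) ys = begin
  length (filter P? (map (x ,_) ys ++ cartesianProduct xs ys))
    ≡⟨ cong length (filter-++ P? (map (x ,_) ys) (cartesianProduct xs ys)) ⟩
  length (filter P? (map (x ,_) ys) ++ filter P? (cartesianProduct xs ys))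
    ≡⟨ length-++ (filter P? (map (x ,_) ys)) ⟩
  length (filter P? (map (x ,_) ys)) + length (filter P? (cartesianProduct xs ys))
    ≡⟨ cong₂ _+_ (length-filter-map P? (x ,_) ys) (length-filter-cartesianProduct P? xs ys) ⟩
  sum (map (λ x → length (filter (P? ∘ (x ,_)) ys)) (x ∷ xs)) ∎
  where open ≡-Reasoning

module DirectionColouring {n t : ℕ} (label : Fin t → Subset n)
  (E : List (Fin t × Fin t))
  (E-ordered : All (λ e → proj₁ e <ᶠ proj₂ e) E)
  (E-unique : Unique E)
  (E-flips : All (λ e → ∃[ i ] Flip i (label (proj₁ e)) (label (proj₂ e))) E)
  where

  -- On an edge the colour is the direction of the flip (firstDiff-flip); elsewhere it is junk.
  graph : ColouredGraph t
  graph = record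
    { edges      = E
    ; ordered    = E-ordered
    ; nodup      = E-unique
    ; colour     = λ u v → firstDiff (label u) (label v)
    ; colour-sym = λ u v → firstDiff-comm (label u) (label v)
    }

  adjacent⇒flip : ∀ {u v} → Adj graph u v → ∃[ i ] Flip i (label u) (label v)
  adjacent⇒flip (inj₁ uv∈E) = All.lookup E-flips uv∈E
  adjacent⇒flip (inj₂ vu∈E) = Product.map₂ flip-sym (All.lookup E-flips vu∈E)

  proper : Injective _≡_ _≡_ label → Proper graph
  proper label-injective u v w u~v u~w v≢w same-colour
    with adjacent⇒flip u~v | adjacent⇒flip u~w
  ... | i , u→v | j , u→w = v≢w (label-injective (flip-unique u→v u→w′))
    where
    i≡j : i ≡ j
    i≡j = toℕ-injective (trans (sym (firstDiff-flip u→v)) (trans same-colour (firstDiff-flip u→w)))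
    u→w′ : Flip i (label u) (label w)
    u→w′ rewrite i≡j = u→w

  AvoidingStep : Fin n → Fin t × Fin t → Set
  AvoidingStep i (u , v) = Adj graph u v × toℕ i ≢ colour graph u v

  step-preserves : ∀ {u v} → AvoidingStep i (u , v) → lookupᵛ (label u) i ≡ lookupᵛ (label v) i
  step-preserves (u~v , i≢c) with adjacent⇒flip u~v
  ... | j , u→v = flip-preserves u→v (λ i≡j → i≢c (trans (cong toℕ i≡j) (sym (firstDiff-flip u→v))))

  walk-preserves : ∀ x ys z → All (AvoidingStep i) (zip (x ∷ ys) (ys ++ [ z ])) →
    lookupᵛ (label x) i ≡ lookupᵛ (label z) i
  walk-preserves x []       z (step ∷ [])    = step-preserves step
  walk-preserves x (y ∷ ys) z (step ∷ steps) = trans (step-preserves step) (walk-preserves y ys z steps)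

  noRainbowCycle : NoRainbowCycle graph
  noRainbowCycle []       (() , _)
  noRainbowCycle (_ ∷ []) (s≤s () , _)
  noRainbowCycle (v₀ ∷ v₁ ∷ vs) (_ , _ , v₀~v₁ ∷ steps) (c₀-fresh ∷ _) with adjacent⇒flip v₀~v₁
  ... | i , v₀→v₁ = flip-changes v₀→v₁ (sym (walk-preserves v₁ vs v₀ (All.zip (steps , avoiding))))
    where
    avoiding : All (λ e → toℕ i ≢ colour graph (proj₁ e) (proj₂ e)) (zip (v₁ ∷ vs) (vs ++ [ v₀ ]))
    avoiding = All.map (λ c₀≢c → c₀≢c ∘ trans (firstDiff-flip v₀→v₁)) (All.map⁻ c₀-fresh)

module InclusionGraph {n k : ℕ} (𝒜 ℬ : List (Subset n))
  (𝒜-family : Family n k 𝒜) (ℬ-family : Family n (suc k) ℬ)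
  where

  a b : ℕ
  a = length 𝒜
  b = length ℬ

  ∣𝒜ᵢ∣≡k : ∀ i → ∣ lookup 𝒜 i ∣ ≡ k
  ∣𝒜ᵢ∣≡k i = All.lookup (proj₂ 𝒜-family) (∈-lookup i)

  ∣ℬⱼ∣≡1+k : ∀ j → ∣ lookup ℬ j ∣ ≡ suc k
  ∣ℬⱼ∣≡1+k j = All.lookup (proj₂ ℬ-family) (∈-lookup j)

  label : Fin (a + b) → Subset n
  label = [ lookup 𝒜 , lookup ℬ ]′ ∘ splitAt a

  label-injective : Injective _≡_ _≡_ label
  label-injective = splitAt-injective a ∘ [,]′-injective
    (lookup-injective (proj₁ 𝒜-family)) (lookup-injective (proj₁ ℬ-family))
    (λ i j 𝒜ᵢ≡ℬⱼ → 1+n≢n (trans (sym (∣ℬⱼ∣≡1+k j)) (trans (cong ∣_∣ (sym 𝒜ᵢ≡ℬⱼ)) (∣𝒜ᵢ∣≡k i))))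

  label-↑ˡ : ∀ i → label (i ↑ˡ b) ≡ lookup 𝒜 i
  label-↑ˡ i = cong [ lookup 𝒜 , lookup ℬ ]′ (splitAt-↑ˡ a i b)

  label-↑ʳ : ∀ j → label (a ↑ʳ j) ≡ lookup ℬ j
  label-↑ʳ j = cong [ lookup 𝒜 , lookup ℬ ]′ (splitAt-↑ʳ a b j)

  Included : Fin a × Fin b → Set
  Included (i , j) = lookup 𝒜 i ⊆ lookup ℬ j

  included? : Decidable Included
  included? (i , j) = lookup 𝒜 i ⊆? lookup ℬ j

  edge : Fin a × Fin b → Fin (a + b) × Fin (a + b)
  edge (i , j) = i ↑ˡ b , a ↑ʳ j

  edge-injective : Injective _≡_ _≡_ edge
  edge-injective {i , j} {i′ , j′} eq =
    cong₂ _,_ (↑ˡ-injective b i i′ (cong proj₁ eq)) (↑ʳ-injective a j j′ (cong proj₂ eq))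

  edge-ordered : ∀ ij → proj₁ (edge ij) <ᶠ proj₂ (edge ij)
  edge-ordered (i , j) rewrite toℕ-↑ˡ i b | toℕ-↑ʳ a j = ≤-trans (toℕ<n i) (m≤m+n a (toℕ j))

  edge-flips : ∀ {ij} → Included ij → ∃[ d ] Flip d (label (proj₁ (edge ij))) (label (proj₂ (edge ij)))
  edge-flips {i , j} 𝒜ᵢ⊆ℬⱼ rewrite label-↑ˡ i | label-↑ʳ j =
    p⊆q∧∣q∣≡1+∣p∣⇒flip 𝒜ᵢ⊆ℬⱼ (trans (∣ℬⱼ∣≡1+k j) (cong suc (sym (∣𝒜ᵢ∣≡k i))))

  includedPairs : List (Fin a × Fin b)
  includedPairs = filter included? (cartesianProduct (allFin a) (allFin b))

  edgeList : List (Fin (a + b) × Fin (a + b))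
  edgeList = map edge includedPairs

  edgeList-ordered : All (λ e → proj₁ e <ᶠ proj₂ e) edgeList
  edgeList-ordered = All.map⁺ (All.tabulate (λ {ij} _ → edge-ordered ij))

  edgeList-unique : Unique edgeList
  edgeList-unique = Unique.map⁺ edge-injective
    (Unique.filter⁺ included? (Unique.cartesianProduct⁺ (Unique.allFin⁺ a) (Unique.allFin⁺ b)))

  edgeList-flips : All (λ e → ∃[ d ] Flip d (label (proj₁ e)) (label (proj₂ e))) edgeList
  edgeList-flips =
    All.map⁺ (All.map edge-flips (All.all-filter included? (cartesianProduct (allFin a) (allFin b))))

  length-supersets : ∀ i →
    length (filter (included? ∘ (i ,_)) (allFin b)) ≡ length (filter (lookup 𝒜 i ⊆?_) ℬ)
  length-supersets i = begin
    length (filter (included? ∘ (i ,_)) (allFin b))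
      ≡⟨ length-filter-map (lookup 𝒜 i ⊆?_) (lookup ℬ) (allFin b) ⟨
    length (filter (lookup 𝒜 i ⊆?_) (map (lookup ℬ) (allFin b)))
      ≡⟨ cong (length ∘ filter (lookup 𝒜 i ⊆?_)) (map-lookup-allFin ℬ) ⟩
    length (filter (lookup 𝒜 i ⊆?_) ℬ) ∎
    where open ≡-Reasoning

  edgeList-count : length edgeList ≡ ξ 𝒜 ℬ
  edgeList-count = begin
    length (map edge includedPairs)
      ≡⟨ length-map edge includedPairs ⟩
    length includedPairs
      ≡⟨ length-filter-cartesianProduct included? (allFin a) (allFin b) ⟩
    sum (map (λ i → length (filter (included? ∘ (i ,_)) (allFin b))) (allFin a))
      ≡⟨ cong sum (map-cong length-supersets (allFin a)) ⟩
    sum (map (supersets ∘ lookup 𝒜) (allFin a))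
      ≡⟨ cong sum (map-∘ (allFin a)) ⟩
    sum (map supersets (map (lookup 𝒜) (allFin a)))
      ≡⟨ cong (sum ∘ map supersets) (map-lookup-allFin 𝒜) ⟩
    ξ 𝒜 ℬ ∎
    where
    open ≡-Reasoning
    supersets : Subset n → ℕ
    supersets A = length (filter (A ⊆?_) ℬ)

lemma2p7 : (n t : ℕ) → 1 ≤ n → 1 ≤ t →
    (k : ℕ) → k < n → (𝒜 ℬ : List (Subset n)) →
    Family n k 𝒜 → Family n (suc k) ℬ → length 𝒜 + length ℬ ≡ t →
    Σ (ColouredGraph t) (λ G → Proper G × NoRainbowCycle G × ξ 𝒜 ℬ ≤ numEdges G)
lemma2p7 n .(length 𝒜 + length ℬ) _ _ k _ 𝒜 ℬ 𝒜-family ℬ-family refl =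
  graph , proper label-injective , noRainbowCycle , ≤-reflexive (sym edgeList-count)
  where
  open InclusionGraph 𝒜 ℬ 𝒜-family ℬ-family
  open DirectionColouring label edgeList edgeList-ordered edgeList-unique edgeList-flips
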